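{- Let $\alpha$ be even and $\beta$ odd. Let $\mathcal C=\langle(b\mid 0),(\ell\mid fh+2f)\rangle$ be the $\mathbb{Z}_2\mathbb{Z}_4$-additive cyclic code in $R_{\alpha,\beta}$ with $b=x^{\alpha/2}-1$, $\ell=0$, $h=x^\beta-1$ and $f=1$. Then $\mathcal C$ is self-dual (i.e. $\mathcal C=\mathcal C^\perp$) and of type $(\alpha,\beta;\beta+\frac{\alpha}{2},0;\frac{\alpha}{2})$.
   Context: A $\mathbb{Z}_2\mathbb{Z}_4$-additive cyclic code is a subgroup of $\mathbb{Z}_2^\alpha\times\mathbb{Z}_4^\beta$ invariant under simultaneously cyclically shifting the binary and quaternary coordinates; vectors are identified with elements of $R_{\alpha,\beta}=\mathbb{Z}_2[x]/(x^\alpha-1)\times\mathbb{Z}_4[x]/(x^\beta-1)$, a $\mathbb{Z}_4[x]$-module via $\lambda\star(p\mid q)=(\lambda p\bmod2\mid\lambda q)$, and $\langle\cdot\rangle$ is the generated submodule. The dual is $\mathcal C^\perp=\{\mathbf v:\mathbf u\cdot\mathbf v=0\ \forall\mathbf u\in\mathcal C\}$ with $\mathbf u\cdot\mathbf v=2\sum_iu_iv_i+\sum_ju'_jv'_j\in\mathbb{Z}_4$ (binary entries read as $0,1\in\mathbb{Z}_4$). Type $(\alpha,\beta;\gamma,\delta;\kappa)$: $\mathcal C\cong\mathbb{Z}_2^\gamma\times\mathbb{Z}_4^\delta$ as groups, and $\kappa$ is the dimension of the projection onto the binary coordinates of the subcode of codewords of order at most 2. -}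

module Defs where

open import Data.Nat as ℕ using (ℕ; zero; suc; NonZero)
open import Data.Nat.DivMod using (_mod_)
open import Data.Fin using (Fin; toℕ)
open import Data.Vec as V using (Vec; []; _∷_; zipWith; replicate; init; last)
open import Data.List as L using (List)
open import Data.Product using (Σ; ∃; ∃₂; _×_; _,_)
open import Relation.Binary.PropositionalEquality using (_≡_)

-- Arithmetic in Z_n = Fin n (residues 0..n-1), vectors over Z_n,
-- the ring Z_n[x] (coefficient lists, lowest degree first) and its
-- action on Z_n[x]/(x^m - 1) (coefficient vectors of length m).

module ZMod (n : ℕ) .{{_ : NonZero n}} where

  Zn : Set
  Zn = Fin n

  0# 1# : Zn
  0# = 0 mod n
  1# = 1 mod n

  _+ₙ_ _*ₙ_ : Zn → Zn → Zn
  a +ₙ b = (toℕ a ℕ.+ toℕ b) mod n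
  a *ₙ b = (toℕ a ℕ.* toℕ b) mod n

  -ₙ_ : Zn → Zn
  -ₙ a = (n ℕ.∸ toℕ a) mod n

  _⊕_ : ∀ {m} → Vec Zn m → Vec Zn m → Vec Zn m
  _⊕_ = zipWith _+ₙ_

  zeroV : ∀ {m} → Vec Zn m
  zeroV = replicate _ 0#

  scaleV : ∀ {m} → Zn → Vec Zn m → Vec Zn m
  scaleV c = V.map (c *ₙ_)

  sumV : ∀ {m} → Vec Zn m → Zn
  sumV = V.foldr _ _+ₙ_ 0#

  dotV : ∀ {m} → Vec Zn m → Vec Zn m → Zn
  dotV u v = sumV (zipWith _*ₙ_ u v)

  -- multiplication by x in Z_n[x]/(x^m - 1): cyclic shift to the right
  rot : ∀ {m} → Vec Zn m → Vec Zn m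
  rot {zero}  []       = []
  rot {suc m} v        = last v ∷ init v

  Poly : Set
  Poly = List Zn

  act : ∀ {m} → Poly → Vec Zn m → Vec Zn m
  act L.[]       v = zeroV
  act (c L.∷ cs) v = scaleV c v ⊕ act cs (rot v)

  e₀ : ∀ m → Vec Zn m
  e₀ zero    = []
  e₀ (suc m) = 1# ∷ zeroV

  reduce : ∀ m → Poly → Vec Zn m
  reduce m p = act p (e₀ m)

  padd : Poly → Poly → Poly
  padd L.[]       q          = q
  padd p          L.[]       = p
  padd (a L.∷ p)  (b L.∷ q)  = (a +ₙ b) L.∷ padd p q

  pscale : Zn → Poly → Poly
  pscale c = L.map (c *ₙ_)

  pneg : Poly → Poly
  pneg = L.map -ₙ_

  psub : Poly → Poly → Poly
  psub p q = padd p (pneg q)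

  pmul : Poly → Poly → Poly
  pmul L.[]      q = L.[]
  pmul (a L.∷ p) q = padd (pscale a q) (0# L.∷ pmul p q)

  pconst : Zn → Poly
  pconst c = c L.∷ L.[]

  X^ : ℕ → Poly
  X^ k = L.replicate k 0# L.++ (1# L.∷ L.[])

module Z2 = ZMod 2
module Z4 = ZMod 4

-- The ambient module R_{α,β} = Z2[x]/(x^α-1) × Z4[x]/(x^β-1)

R : ℕ → ℕ → Set
R α β = Vec (Fin 2) α × Vec (Fin 4) β

mod2 : Fin 4 → Fin 2
mod2 a = toℕ a mod 2

-- binary entries read as 0,1 ∈ Z4
lift : Fin 2 → Fin 4
lift a = toℕ a mod 4

_⊞_ : ∀ {α β} → R α β → R α β → R α β
(p , q) ⊞ (p' , q') = (p Z2.⊕ p') , (q Z4.⊕ q')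

zeroR : ∀ {α β} → R α β
zeroR = Z2.zeroV , Z4.zeroV

_⋆_ : ∀ {α β} → Z4.Poly → R α β → R α β
l ⋆ (p , q) = Z2.act (L.map mod2 l) p , Z4.act l q

Span : ∀ {α β k} → Vec (R α β) k → R α β → Set
Span {α} {β} {k} gs v =
  Σ (Vec Z4.Poly k) λ ls → v ≡ V.foldr _ _⊞_ zeroR (zipWith _⋆_ ls gs)

inner : ∀ {α β} → R α β → R α β → Fin 4
inner (u , u') (v , v') =
  ((2 mod 4) Z4.*ₙ Z4.dotV (V.map lift u) (V.map lift v)) Z4.+ₙ Z4.dotV u' v'

Dual : ∀ {α β} → (R α β → Set) → R α β → Set
Dual C v = ∀ u → C u → inner u v ≡ Z4.0#

SelfDual : ∀ {α β} → (R α β → Set) → Set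
SelfDual C = ∀ v → (C v → Dual C v) × (Dual C v → C v)

_+G_ : ∀ {γ δ} → Vec (Fin 2) γ × Vec (Fin 4) δ → Vec (Fin 2) γ × Vec (Fin 4) δ
     → Vec (Fin 2) γ × Vec (Fin 4) δ
(a , b) +G (a' , b') = (a Z2.⊕ a') , (b Z4.⊕ b')

-- C ≅ Z2^γ × Z4^δ as groups: an injective group homomorphism
-- Z2^γ × Z4^δ → R_{α,β} whose image is exactly C
GroupIso : ∀ {α β} → (R α β → Set) → ℕ → ℕ → Set
GroupIso {α} {β} C γ δ =
  Σ (Vec (Fin 2) γ × Vec (Fin 4) δ → R α β) λ φ →
    (∀ a b → φ (a +G b) ≡ φ a ⊞ φ b)
  × (∀ a b → φ a ≡ φ b → a ≡ b)
  × (∀ v → (C v → ∃ λ a → φ a ≡ v) × (∃ (λ a → φ a ≡ v) → C v))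

HasDim : ∀ {α} → (Vec (Fin 2) α → Set) → ℕ → Set
HasDim {α} S κ =
  Σ (Vec (Vec (Fin 2) α) κ) λ basis →
    let comb : Vec (Fin 2) κ → Vec (Fin 2) α
        comb c = V.foldr _ Z2._⊕_ Z2.zeroV (zipWith Z2.scaleV c basis)
    in (∀ c c' → comb c ≡ comb c' → c ≡ c')
     × (∀ w → (S w → ∃ λ c → comb c ≡ w) × (∃ (λ c → comb c ≡ w) → S w))

-- projection onto the binary coordinates of the subcode of codewords of order ≤ 2
BinProjOrder2 : ∀ {α β} → (R α β → Set) → Vec (Fin 2) α → Set
BinProjOrder2 {α} {β} C w =
  Σ (Vec (Fin 4) β) λ q → C (w , q) × ((w , q) ⊞ (w , q) ≡ zeroR)

HasType : ∀ α β → (R α β → Set) → ℕ → ℕ → ℕ → Set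
HasType α β C γ δ κ = GroupIso C γ δ × HasDim (BinProjOrder2 C) κ

bPoly : ℕ → Z2.Poly
bPoly α = Z2.psub (Z2.X^ (α ℕ./ 2)) (Z2.pconst Z2.1#)

ℓPoly : Z2.Poly
ℓPoly = L.[]

hPoly : ℕ → Z4.Poly
hPoly β = Z4.psub (Z4.X^ β) (Z4.pconst Z4.1#)

fPoly : Z4.Poly
fPoly = Z4.pconst Z4.1#

gen₁ : ∀ α β → R α β
gen₁ α β = Z2.reduce α (bPoly α) , Z4.zeroV

gen₂ : ∀ α β → R α β
gen₂ α β = Z2.reduce α ℓPoly
         , Z4.reduce β (Z4.padd (Z4.pmul fPoly (hPoly β)) (Z4.pscale (2 mod 4) fPoly))

Code : ∀ α β → R α β → Set
Code α β = Span (gen₁ α β ∷ gen₂ α β ∷ [])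

module Submission where

-- Let α = 2m.  The proof first computes the code explicitly: the generator
-- b = x^m - 1 reduces to (1,0,…,0 | 1,0,…,0) in Z2[x]/(x^2m - 1), and
-- f h + 2f = x^β + 1 reduces to 2 in Z4[x]/(x^β - 1).  Since doubling
-- u ↦ (u | u) commutes with the Z4[x]-action and every vector is the
-- reduction of its own coefficient list, the code is exactly
--     C = { (u | u | 2a) : u ∈ Z2^m, a ∈ Z2^β }.
-- Everything then follows from this description:
--   * C ⊆ C⊥, because 2·2(u·u') = 0 and (2a)·(2a') = 0 in Z4;
--   * C⊥ ⊆ C, by testing against (eᵢ | eᵢ | 0) and (0 | 0 | 2eⱼ);
--   * (a | u) ↦ (u | u | 2a) is a group isomorphism Z2^(β+m) ≅ C, so γ = β + m, δ = 0;
--   * the binary parts of codewords of order ≤ 2 are the (u | u), so κ = m.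

open import Defs
open import Data.Nat using (ℕ; _+_; _/_; _%_)
open import Data.Product using (_×_)
open import Relation.Binary.PropositionalEquality using (_≡_)

open import Data.Nat using (zero; suc; NonZero; _*_; _≤_; z≤n; s≤s)
open import Data.Nat.DivMod using (_mod_; m*n/n≡m; m≡m%n+[m/n]*n; m%n<n; m%n%n≡m%n; m<n⇒m%n≡m; %-distribˡ-+; %-distribˡ-*)
import Data.Nat.Properties as ℕP
open import Algebra.Properties.CommutativeSemigroup ℕP.*-commutativeSemigroup using (x∙yz≈y∙xz)
open import Data.Fin as Fin using (Fin; toℕ)
open import Data.Vec as V using (Vec; []; _∷_; _++_; _∷ʳ_; zipWith; replicate; init; last; initLast; toList)
import Data.Vec.Properties as VP
import Data.List.Properties as LP
import Data.List as L
open import Data.Product using (Σ; ∃; _,_; proj₁; proj₂)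
open import Data.Fin.Properties using (toℕ-fromℕ<; toℕ-injective; toℕ<n)
open import Relation.Binary.PropositionalEquality using (refl; sym; trans; cong; cong₂; module ≡-Reasoning)

module ZModLaws (n : ℕ) .{{_ : NonZero n}} where
  open ZMod n
  open ≡-Reasoning

  toℕ-mod : ∀ m → toℕ (m mod n) ≡ m % n
  toℕ-mod m = toℕ-fromℕ< (m%n<n m n)

  mod-cong : ∀ {x y} → x % n ≡ y % n → x mod n ≡ y mod n
  mod-cong {x} {y} e = toℕ-injective (trans (toℕ-mod x) (trans e (sym (toℕ-mod y))))

  mod-toℕ : ∀ (a : Zn) → toℕ a mod n ≡ a
  mod-toℕ a = toℕ-injective (trans (toℕ-mod (toℕ a)) (m<n⇒m%n≡m (toℕ<n a)))

  module Absorb (_∙_ : ℕ → ℕ → ℕ)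
                (%-distrib : ∀ x y → (x ∙ y) % n ≡ ((x % n) ∙ (y % n)) % n) where

    absorbʳ : ∀ x y → (x ∙ toℕ (y mod n)) mod n ≡ (x ∙ y) mod n
    absorbʳ x y = mod-cong (begin
      (x ∙ toℕ (y mod n)) % n          ≡⟨ cong (λ t → (x ∙ t) % n) (toℕ-mod y) ⟩
      (x ∙ (y % n)) % n                ≡⟨ %-distrib x (y % n) ⟩
      ((x % n) ∙ (y % n % n)) % n      ≡⟨ cong (λ t → ((x % n) ∙ t) % n) (m%n%n≡m%n y n) ⟩
      ((x % n) ∙ (y % n)) % n          ≡⟨ sym (%-distrib x y) ⟩
      (x ∙ y) % n                      ∎)

    absorbˡ : ∀ x y → (toℕ (x mod n) ∙ y) mod n ≡ (x ∙ y) mod n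
    absorbˡ x y = mod-cong (begin
      (toℕ (x mod n) ∙ y) % n          ≡⟨ cong (λ t → (t ∙ y) % n) (toℕ-mod x) ⟩
      ((x % n) ∙ y) % n                ≡⟨ %-distrib (x % n) y ⟩
      ((x % n % n) ∙ (y % n)) % n      ≡⟨ cong (λ t → (t ∙ (y % n)) % n) (m%n%n≡m%n x n) ⟩
      ((x % n) ∙ (y % n)) % n          ≡⟨ sym (%-distrib x y) ⟩
      (x ∙ y) % n                      ∎)

  open Absorb _+_ (λ x y → %-distribˡ-+ x y n) renaming (absorbʳ to +-absorbʳ; absorbˡ to +-absorbˡ)
  open Absorb _*_ (λ x y → %-distribˡ-* x y n) renaming (absorbʳ to *-absorbʳ; absorbˡ to *-absorbˡ)

  +-identityʳ : ∀ a → a +ₙ 0# ≡ a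
  +-identityʳ a = trans (+-absorbʳ (toℕ a) 0) (trans (cong (_mod n) (ℕP.+-identityʳ (toℕ a))) (mod-toℕ a))

  +-identityˡ : ∀ a → 0# +ₙ a ≡ a
  +-identityˡ a = trans (+-absorbˡ 0 (toℕ a)) (mod-toℕ a)

  +-assoc : ∀ a b c → (a +ₙ b) +ₙ c ≡ a +ₙ (b +ₙ c)
  +-assoc a b c = begin
    (a +ₙ b) +ₙ c                       ≡⟨ +-absorbˡ (toℕ a + toℕ b) (toℕ c) ⟩
    ((toℕ a + toℕ b) + toℕ c) mod n     ≡⟨ cong (_mod n) (ℕP.+-assoc (toℕ a) (toℕ b) (toℕ c)) ⟩
    (toℕ a + (toℕ b + toℕ c)) mod n     ≡⟨ sym (+-absorbʳ (toℕ a) (toℕ b + toℕ c)) ⟩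
    a +ₙ (b +ₙ c)                       ∎

  *-zeroʳ : ∀ a → a *ₙ 0# ≡ 0#
  *-zeroʳ a = trans (*-absorbʳ (toℕ a) 0) (cong (_mod n) (ℕP.*-zeroʳ (toℕ a)))

  *-zeroˡ : ∀ a → 0# *ₙ a ≡ 0#
  *-zeroˡ a = *-absorbˡ 0 (toℕ a)

  *-identityʳ : ∀ a → a *ₙ 1# ≡ a
  *-identityʳ a = trans (*-absorbʳ (toℕ a) 1) (trans (cong (_mod n) (ℕP.*-identityʳ (toℕ a))) (mod-toℕ a))

  *-identityˡ : ∀ a → 1# *ₙ a ≡ a
  *-identityˡ a = trans (*-absorbˡ 1 (toℕ a)) (trans (cong (_mod n) (ℕP.*-identityˡ (toℕ a))) (mod-toℕ a))

  *-exchange : ∀ c d a → c *ₙ (d *ₙ a) ≡ d *ₙ (c *ₙ a)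
  *-exchange c d a = begin
    c *ₙ (d *ₙ a)                  ≡⟨ *-absorbʳ (toℕ c) (toℕ d * toℕ a) ⟩
    (toℕ c * (toℕ d * toℕ a)) mod n ≡⟨ cong (_mod n) (x∙yz≈y∙xz (toℕ c) (toℕ d) (toℕ a)) ⟩
    (toℕ d * (toℕ c * toℕ a)) mod n ≡⟨ sym (*-absorbʳ (toℕ d) (toℕ c * toℕ a)) ⟩
    d *ₙ (c *ₙ a)                  ∎

  *-distribˡ-+ : ∀ d a b → d *ₙ (a +ₙ b) ≡ (d *ₙ a) +ₙ (d *ₙ b)
  *-distribˡ-+ d a b = begin
    d *ₙ (a +ₙ b)                                  ≡⟨ *-absorbʳ (toℕ d) (toℕ a + toℕ b) ⟩
    (toℕ d * (toℕ a + toℕ b)) mod n                ≡⟨ cong (_mod n) (ℕP.*-distribˡ-+ (toℕ d) (toℕ a) (toℕ b)) ⟩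
    (toℕ d * toℕ a + toℕ d * toℕ b) mod n          ≡⟨ sym (+-absorbˡ (toℕ d * toℕ a) (toℕ d * toℕ b)) ⟩
    (toℕ (d *ₙ a) + toℕ d * toℕ b) mod n           ≡⟨ sym (+-absorbʳ (toℕ (d *ₙ a)) (toℕ d * toℕ b)) ⟩
    (d *ₙ a) +ₙ (d *ₙ b)                           ∎

double : ∀ {A : Set} {k} → Vec A k → Vec A (k + k)
double u = u ++ u

init-∷ʳ-++ : ∀ {A : Set} {a b} (zs : Vec A a) y (w : Vec A (suc b)) → init ((zs ∷ʳ y) ++ w) ≡ zs ++ (y ∷ init w)
init-∷ʳ-++ []       y w = refl
init-∷ʳ-++ (z ∷ zs) y w = cong (z ∷_) (init-∷ʳ-++ zs y w)

last-∷ʳ-++ : ∀ {A : Set} {a b} (zs : Vec A a) y (w : Vec A (suc b)) → last ((zs ∷ʳ y) ++ w) ≡ last w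
last-∷ʳ-++ []       y w = refl
last-∷ʳ-++ (z ∷ zs) y w = last-∷ʳ-++ zs y w

replicate-++ : ∀ {A : Set} a b (x : A) → replicate (a + b) x ≡ replicate a x ++ replicate b x
replicate-++ zero    b x = refl
replicate-++ (suc a) b x = cong (x ∷_) (replicate-++ a b x)

pointwise-≡ : ∀ {A : Set} {k} (p q : Vec A k) → (∀ i → V.lookup p i ≡ V.lookup q i) → p ≡ q
pointwise-≡ p q h = trans (sym (VP.tabulate∘lookup p)) (trans (VP.tabulate-cong h) (VP.tabulate∘lookup q))

vec-empty : ∀ {A : Set} (v : Vec A 0) → v ≡ []
vec-empty [] = refl

take-drop-++ : ∀ {A : Set} k {l} (a : Vec A k) (u : Vec A l) → V.take k (a ++ u) ≡ a × V.drop k (a ++ u) ≡ u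
take-drop-++ k a u = VP.++-injective (V.take k (a ++ u)) a (VP.take++drop≡id k (a ++ u))

module VecLaws (n : ℕ) .{{_ : NonZero n}} where
  open ZMod n
  open ZModLaws n
  open ≡-Reasoning

  ⊕-identityʳ : ∀ {k} (v : Vec Zn k) → v ⊕ zeroV ≡ v
  ⊕-identityʳ []      = refl
  ⊕-identityʳ (x ∷ v) = cong₂ _∷_ (+-identityʳ x) (⊕-identityʳ v)

  ⊕-identityˡ : ∀ {k} (v : Vec Zn k) → zeroV ⊕ v ≡ v
  ⊕-identityˡ []      = refl
  ⊕-identityˡ (x ∷ v) = cong₂ _∷_ (+-identityˡ x) (⊕-identityˡ v)

  scale-zero : ∀ {k} c → scaleV c (zeroV {k}) ≡ zeroV
  scale-zero {zero}  c = refl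
  scale-zero {suc k} c = cong₂ _∷_ (*-zeroʳ c) (scale-zero c)

  scale-⊕ : ∀ {k} d (u v : Vec Zn k) → scaleV d (u ⊕ v) ≡ scaleV d u ⊕ scaleV d v
  scale-⊕ d []      []      = refl
  scale-⊕ d (x ∷ u) (y ∷ v) = cong₂ _∷_ (*-distribˡ-+ d x y) (scale-⊕ d u v)

  scale-exchange : ∀ {k} c d (v : Vec Zn k) → scaleV c (scaleV d v) ≡ scaleV d (scaleV c v)
  scale-exchange c d []      = refl
  scale-exchange c d (x ∷ v) = cong₂ _∷_ (*-exchange c d x) (scale-exchange c d v)

  rot-∷ʳ : ∀ {k} (w : Vec Zn k) z → rot (w ∷ʳ z) ≡ z ∷ w
  rot-∷ʳ w z = cong₂ _∷_ (VP.last-∷ʳ z w) (VP.init-∷ʳ z w)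

  zipWith-∷ʳ : ∀ {k} (f : Zn → Zn → Zn) (u v : Vec Zn k) x y →
               zipWith f (u ∷ʳ x) (v ∷ʳ y) ≡ zipWith f u v ∷ʳ f x y
  zipWith-∷ʳ f []      []      x y = refl
  zipWith-∷ʳ f (a ∷ u) (b ∷ v) x y = cong (f a b ∷_) (zipWith-∷ʳ f u v x y)

  rot-⊕ : ∀ {k} (u v : Vec Zn k) → rot (u ⊕ v) ≡ rot u ⊕ rot v
  rot-⊕ {zero}  [] [] = refl
  -- (matching on 'initLast' also rewrites 'rot u' in the goal to 'x ∷ u'')
  rot-⊕ {suc k} u v with initLast u | initLast v
  ... | u' , x , refl | v' , y , refl = begin
    rot ((u' ∷ʳ x) ⊕ (v' ∷ʳ y))    ≡⟨ cong rot (zipWith-∷ʳ _+ₙ_ u' v' x y) ⟩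
    rot ((u' ⊕ v') ∷ʳ (x +ₙ y))     ≡⟨ rot-∷ʳ (u' ⊕ v') (x +ₙ y) ⟩
    (x ∷ u') ⊕ (y ∷ v')            ∎

  rot-map : ∀ {k} (f : Zn → Zn) (u : Vec Zn k) → rot (V.map f u) ≡ V.map f (rot u)
  rot-map {zero}  f [] = refl
  rot-map {suc k} f u with initLast u
  ... | u' , x , refl = begin
    rot (V.map f (u' ∷ʳ x))  ≡⟨ cong rot (VP.map-∷ʳ f x u') ⟩
    rot (V.map f u' ∷ʳ f x)  ≡⟨ rot-∷ʳ (V.map f u') (f x) ⟩
    V.map f (x ∷ u')         ∎

  replicate-∷ʳ : ∀ k (a : Zn) → replicate (suc k) a ≡ replicate k a ∷ʳ a
  replicate-∷ʳ zero    a = refl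
  replicate-∷ʳ (suc k) a = cong (a ∷_) (replicate-∷ʳ k a)

  rot-zero : ∀ {k} → rot (zeroV {k}) ≡ zeroV
  rot-zero {zero}  = refl
  rot-zero {suc k} = trans (cong rot (replicate-∷ʳ k 0#)) (rot-∷ʳ (replicate k 0#) 0#)

  act-rot : ∀ {k} p (v : Vec Zn k) → act p (rot v) ≡ rot (act p v)
  act-rot L.[]       v = sym rot-zero
  act-rot (c L.∷ cs) v = begin
    scaleV c (rot v) ⊕ act cs (rot (rot v))   ≡⟨ cong₂ _⊕_ (sym (rot-map (c *ₙ_) v)) (act-rot cs (rot v)) ⟩
    rot (scaleV c v) ⊕ rot (act cs (rot v))   ≡⟨ sym (rot-⊕ (scaleV c v) (act cs (rot v))) ⟩
    rot (scaleV c v ⊕ act cs (rot v))         ∎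

  act-zero : ∀ {k} p → act p (zeroV {k}) ≡ zeroV
  act-zero L.[]       = refl
  act-zero (c L.∷ cs) = begin
    scaleV c zeroV ⊕ act cs (rot zeroV)  ≡⟨ cong₂ _⊕_ (scale-zero c) (trans (cong (act cs) rot-zero) (act-zero cs)) ⟩
    zeroV ⊕ zeroV                        ≡⟨ ⊕-identityʳ zeroV ⟩
    zeroV                                ∎

  act-scale : ∀ {k} p d (v : Vec Zn k) → act p (scaleV d v) ≡ scaleV d (act p v)
  act-scale L.[]       d v = sym (scale-zero d)
  act-scale (c L.∷ cs) d v = begin
    scaleV c (scaleV d v) ⊕ act cs (rot (scaleV d v))  ≡⟨ cong₂ _⊕_ (scale-exchange c d v)
                                                            (trans (cong (act cs) (rot-map (d *ₙ_) v)) (act-scale cs d (rot v))) ⟩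
    scaleV d (scaleV c v) ⊕ scaleV d (act cs (rot v))  ≡⟨ sym (scale-⊕ d (scaleV c v) (act cs (rot v))) ⟩
    scaleV d (scaleV c v ⊕ act cs (rot v))             ∎

  padTo : Poly → (N : ℕ) → Vec Zn N
  padTo L.[]       N       = zeroV
  padTo (x L.∷ p)  zero    = []
  padTo (x L.∷ p)  (suc N) = x ∷ padTo p N

  padTo-∷ʳ : ∀ p N → L.length p ≤ N → padTo p (suc N) ≡ padTo p N ∷ʳ 0#
  padTo-∷ʳ L.[]      N       _       = replicate-∷ʳ N 0#
  padTo-∷ʳ (x L.∷ p) (suc N) (s≤s h) = cong (x ∷_) (padTo-∷ʳ p N h)

  act-padTo : ∀ p N → L.length p ≤ N → act p (e₀ N) ≡ padTo p N
  act-padTo L.[]       N       _       = refl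
  act-padTo (c L.∷ p)  (suc N) (s≤s h) = begin
    scaleV c (e₀ (suc N)) ⊕ act p (rot (e₀ (suc N)))  ≡⟨ cong (scaleV c (e₀ (suc N)) ⊕_) shifted ⟩
    (c *ₙ 1# ∷ scaleV c zeroV) ⊕ (0# ∷ padTo p N)     ≡⟨ cong₂ _∷_ (trans (+-identityʳ _) (*-identityʳ c))
                                                          (trans (cong (_⊕ padTo p N) (scale-zero c)) (⊕-identityˡ (padTo p N))) ⟩
    c ∷ padTo p N                                      ∎
    where
    shifted : act p (rot (e₀ (suc N))) ≡ 0# ∷ padTo p N
    shifted = begin
      act p (rot (e₀ (suc N)))   ≡⟨ act-rot p (e₀ (suc N)) ⟩
      rot (act p (e₀ (suc N)))   ≡⟨ cong rot (act-padTo p (suc N) (ℕP.m≤n⇒m≤1+n h)) ⟩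
      rot (padTo p (suc N))      ≡⟨ cong rot (padTo-∷ʳ p N h) ⟩
      rot (padTo p N ∷ʳ 0#)      ≡⟨ rot-∷ʳ (padTo p N) 0# ⟩
      0# ∷ padTo p N             ∎

  reduce-toList : ∀ {k} (u : Vec Zn k) → reduce k (toList u) ≡ u
  reduce-toList {k} u = trans (act-padTo (toList u) k (length≤ u)) (padTo-toList u)
    where
    length≤ : ∀ {k} (u : Vec Zn k) → L.length (toList u) ≤ k
    length≤ []      = z≤n
    length≤ (x ∷ u) = s≤s (length≤ u)
    padTo-toList : ∀ {k} (u : Vec Zn k) → padTo (toList u) k ≡ u
    padTo-toList []      = refl
    padTo-toList (x ∷ u) = cong (x ∷_) (padTo-toList u)

  padTo-X^ : ∀ k N → padTo (X^ k) (k + suc N) ≡ replicate k 0# ++ (1# ∷ zeroV)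
  padTo-X^ zero    N = refl
  padTo-X^ (suc k) N = cong (0# ∷_) (padTo-X^ k N)

  padTo-X^-last : ∀ k → padTo (X^ k) (suc k) ≡ replicate k 0# ∷ʳ 1#
  padTo-X^-last zero    = refl
  padTo-X^-last (suc k) = cong (0# ∷_) (padTo-X^-last k)

  length-X^ : ∀ k → L.length (X^ k) ≡ suc k
  length-X^ zero    = refl
  length-X^ (suc k) = cong suc (length-X^ k)

  reduce-c+X^ : ∀ c k → reduce (suc k) (c L.∷ X^ k) ≡ scaleV c (e₀ (suc k)) ⊕ (1# ∷ zeroV)
  reduce-c+X^ c k = cong (scaleV c (e₀ (suc k)) ⊕_) (begin
    act (X^ k) (rot (e₀ (suc k)))  ≡⟨ act-rot (X^ k) (e₀ (suc k)) ⟩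
    rot (reduce (suc k) (X^ k))    ≡⟨ cong rot (act-padTo (X^ k) (suc k) (ℕP.≤-reflexive (length-X^ k))) ⟩
    rot (padTo (X^ k) (suc k))     ≡⟨ cong rot (padTo-X^-last k) ⟩
    rot (replicate k 0# ∷ʳ 1#)     ≡⟨ rot-∷ʳ (replicate k 0#) 1# ⟩
    1# ∷ zeroV                     ∎)

  padd-identityʳ : ∀ p → padd p L.[] ≡ p
  padd-identityʳ L.[]      = refl
  padd-identityʳ (x L.∷ p) = refl

  pscale-identity : ∀ p → pscale 1# p ≡ p
  pscale-identity L.[]      = refl
  pscale-identity (x L.∷ p) = cong₂ L._∷_ (*-identityˡ x) (pscale-identity p)

  -- Doubling u ↦ (u | u) is a Z_n[x]-module map Z_n[x]/(x^k-1) → Z_n[x]/(x^2k-1),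
  -- because shifting (u | u) cyclically shifts both halves.
  rot-double : ∀ {k} (u : Vec Zn k) → rot (double u) ≡ double (rot u)
  rot-double {zero}  [] = refl
  rot-double {suc k} u with initLast u
  ... | ys , y , refl =
    cong₂ _∷_ (trans (last-∷ʳ-++ ys y (ys ∷ʳ y)) (VP.last-∷ʳ y ys))
              (trans (init-∷ʳ-++ ys y (ys ∷ʳ y)) (cong (λ t → ys ++ (y ∷ t)) (VP.init-∷ʳ y ys)))

  double-⊕ : ∀ {k} (u v : Vec Zn k) → double u ⊕ double v ≡ double (u ⊕ v)
  double-⊕ u v = VP.zipWith-++ _+ₙ_ u u v v

  double-scale : ∀ {k} c (u : Vec Zn k) → scaleV c (double u) ≡ double (scaleV c u)
  double-scale c u = VP.map-++ (c *ₙ_) u u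

  double-zero : ∀ {k} → zeroV {k + k} ≡ double (zeroV {k})
  double-zero {k} = replicate-++ k k 0#

  act-double : ∀ {k} p (u : Vec Zn k) → act p (double u) ≡ double (act p u)
  act-double {k} L.[]       u = double-zero {k}
  act-double     (c L.∷ cs) u = begin
    scaleV c (double u) ⊕ act cs (rot (double u))     ≡⟨ cong₂ _⊕_ (double-scale c u)
                                                          (trans (cong (act cs) (rot-double u)) (act-double cs (rot u))) ⟩
    double (scaleV c u) ⊕ double (act cs (rot u))     ≡⟨ double-⊕ (scaleV c u) (act cs (rot u)) ⟩
    double (scaleV c u ⊕ act cs (rot u))              ∎

  dot-++ : ∀ {k l} (p q : Vec Zn k) (p' q' : Vec Zn l) → dotV (p ++ p') (q ++ q') ≡ dotV p q +ₙ dotV p' q'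
  dot-++ []      []      p' q' = sym (+-identityˡ _)
  dot-++ (x ∷ p) (y ∷ q) p' q' = begin
    (x *ₙ y) +ₙ dotV (p ++ p') (q ++ q')        ≡⟨ cong ((x *ₙ y) +ₙ_) (dot-++ p q p' q') ⟩
    (x *ₙ y) +ₙ (dotV p q +ₙ dotV p' q')        ≡⟨ sym (+-assoc (x *ₙ y) (dotV p q) (dotV p' q')) ⟩
    ((x *ₙ y) +ₙ dotV p q) +ₙ dotV p' q'        ∎

  dot-zeroˡ : ∀ {k} (w : Vec Zn k) → dotV zeroV w ≡ 0#
  dot-zeroˡ []      = refl
  dot-zeroˡ (x ∷ w) = trans (cong₂ _+ₙ_ (*-zeroˡ x) (dot-zeroˡ w)) (+-identityʳ 0#)

  unit : ∀ {k} → Fin k → Vec Zn k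
  unit Fin.zero    = 1# ∷ zeroV
  unit (Fin.suc i) = 0# ∷ unit i

  dot-scaled-unit : ∀ {k} c (i : Fin k) (w : Vec Zn k) → dotV (scaleV c (unit i)) w ≡ c *ₙ V.lookup w i
  dot-scaled-unit c Fin.zero    (x ∷ w) = begin
    ((c *ₙ 1#) *ₙ x) +ₙ dotV (scaleV c zeroV) w  ≡⟨ cong₂ _+ₙ_ (cong (_*ₙ x) (*-identityʳ c))
                                                     (trans (cong (λ t → dotV t w) (scale-zero c)) (dot-zeroˡ w)) ⟩
    (c *ₙ x) +ₙ 0#                                ≡⟨ +-identityʳ (c *ₙ x) ⟩
    c *ₙ x                                        ∎
  dot-scaled-unit c (Fin.suc i) (x ∷ w) = begin
    ((c *ₙ 0#) *ₙ x) +ₙ dotV (scaleV c (unit i)) w  ≡⟨ cong₂ _+ₙ_ (trans (cong (_*ₙ x) (*-zeroʳ c)) (*-zeroˡ x))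
                                                       (dot-scaled-unit c i w) ⟩
    0# +ₙ (c *ₙ V.lookup w i)                        ≡⟨ +-identityˡ _ ⟩
    c *ₙ V.lookup w i                                ∎

  scale-identity : ∀ {k} (v : Vec Zn k) → scaleV 1# v ≡ v
  scale-identity v = trans (VP.map-cong *-identityˡ v) (VP.map-id v)

  dot-unit : ∀ {k} (i : Fin k) (w : Vec Zn k) → dotV (unit i) w ≡ V.lookup w i
  dot-unit i w = begin
    dotV (unit i) w               ≡⟨ cong (λ t → dotV t w) (sym (scale-identity (unit i))) ⟩
    dotV (scaleV 1# (unit i)) w   ≡⟨ dot-scaled-unit 1# i w ⟩
    1# *ₙ V.lookup w i            ≡⟨ *-identityˡ _ ⟩
    V.lookup w i                  ∎

  lincomb : ∀ {k N} → Vec Zn k → Vec (Vec Zn N) k → Vec Zn N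
  lincomb c B = V.foldr _ _⊕_ zeroV (zipWith scaleV c B)

  lincomb-double : ∀ {k N} (c : Vec Zn k) (B : Vec (Vec Zn N) k) → lincomb c (V.map double B) ≡ double (lincomb c B)
  lincomb-double {N = N} []       []      = double-zero {N}
  lincomb-double         (c ∷ cs) (b ∷ B) = begin
    scaleV c (double b) ⊕ lincomb cs (V.map double B)  ≡⟨ cong₂ _⊕_ (double-scale c b) (lincomb-double cs B) ⟩
    double (scaleV c b) ⊕ double (lincomb cs B)        ≡⟨ double-⊕ (scaleV c b) (lincomb cs B) ⟩
    double (scaleV c b ⊕ lincomb cs B)                 ∎

  lincomb-shift : ∀ {k N} (c : Vec Zn k) (f : Fin k → Vec Zn N) →
                  lincomb c (V.tabulate (λ i → 0# ∷ f i)) ≡ 0# ∷ lincomb c (V.tabulate f)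
  lincomb-shift []       f = refl
  lincomb-shift (c ∷ cs) f = begin
    scaleV c (0# ∷ f Fin.zero) ⊕ lincomb cs (V.tabulate (λ i → 0# ∷ f (Fin.suc i)))
      ≡⟨ cong (scaleV c (0# ∷ f Fin.zero) ⊕_) (lincomb-shift cs (λ i → f (Fin.suc i))) ⟩
    (c *ₙ 0# ∷ scaleV c (f Fin.zero)) ⊕ (0# ∷ lincomb cs (V.tabulate (λ i → f (Fin.suc i))))
      ≡⟨ cong (_∷ (scaleV c (f Fin.zero) ⊕ lincomb cs (V.tabulate (λ i → f (Fin.suc i)))))
              (trans (+-identityʳ _) (*-zeroʳ c)) ⟩
    0# ∷ (scaleV c (f Fin.zero) ⊕ lincomb cs (V.tabulate (λ i → f (Fin.suc i))))  ∎

  lincomb-units : ∀ {k} (c : Vec Zn k) → lincomb c (V.tabulate unit) ≡ c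
  lincomb-units []       = refl
  lincomb-units (c ∷ cs) = begin
    (c *ₙ 1# ∷ scaleV c zeroV) ⊕ lincomb cs (V.tabulate (λ i → 0# ∷ unit i))  ≡⟨ cong (_ ⊕_) (lincomb-shift cs unit) ⟩
    (c *ₙ 1# ∷ scaleV c zeroV) ⊕ (0# ∷ lincomb cs (V.tabulate unit))          ≡⟨ cong₂ _∷_ (trans (+-identityʳ _) (*-identityʳ c))
                                                                                   (trans (cong (_⊕ _) (scale-zero c)) (⊕-identityˡ _)) ⟩
    c ∷ lincomb cs (V.tabulate unit)                                          ≡⟨ cong (c ∷_) (lincomb-units cs) ⟩
    c ∷ cs                                                                    ∎

module Z2L = VecLaws 2
module Z4L = VecLaws 4
module Z4A = ZModLaws 4

two : Fin 4
two = 2 mod 4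

dbl : Fin 2 → Fin 4
dbl x = two Z4.*ₙ lift x

hlf : Fin 4 → Fin 2
hlf a = toℕ a / 2 mod 2

pattern 0₂ = Fin.zero
pattern 1₂ = Fin.suc Fin.zero
pattern 0₄ = Fin.zero
pattern 1₄ = Fin.suc Fin.zero
pattern 2₄ = Fin.suc (Fin.suc Fin.zero)
pattern 3₄ = Fin.suc (Fin.suc (Fin.suc Fin.zero))

mod2-lift : ∀ x → mod2 (lift x) ≡ x
mod2-lift 0₂ = refl
mod2-lift 1₂ = refl

two*≡dbl∘mod2 : ∀ a → two Z4.*ₙ a ≡ dbl (mod2 a)
two*≡dbl∘mod2 0₄ = refl
two*≡dbl∘mod2 1₄ = refl
two*≡dbl∘mod2 2₄ = refl
two*≡dbl∘mod2 3₄ = refl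

dbl-+ : ∀ x y → dbl (x Z2.+ₙ y) ≡ dbl x Z4.+ₙ dbl y
dbl-+ 0₂ 0₂ = refl
dbl-+ 0₂ 1₂ = refl
dbl-+ 1₂ 0₂ = refl
dbl-+ 1₂ 1₂ = refl

dbl-injective : ∀ x y → dbl x ≡ dbl y → x ≡ y
dbl-injective 0₂ 0₂ _ = refl
dbl-injective 0₂ 1₂ ()
dbl-injective 1₂ 0₂ ()
dbl-injective 1₂ 1₂ _ = refl

dbl*dbl : ∀ x y → dbl x Z4.*ₙ dbl y ≡ Z4.0#
dbl*dbl 0₂ 0₂ = refl
dbl*dbl 0₂ 1₂ = refl
dbl*dbl 1₂ 0₂ = refl
dbl*dbl 1₂ 1₂ = refl

two*[s+s] : ∀ s → two Z4.*ₙ (s Z4.+ₙ s) ≡ Z4.0#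
two*[s+s] 0₄ = refl
two*[s+s] 1₄ = refl
two*[s+s] 2₄ = refl
two*[s+s] 3₄ = refl

x+x≡0 : ∀ x → x Z2.+ₙ x ≡ Z2.0#
x+x≡0 0₂ = refl
x+x≡0 1₂ = refl

two*[a+b]≡0 : ∀ a b → two Z4.*ₙ (lift a Z4.+ₙ lift b) ≡ Z4.0# → a ≡ b
two*[a+b]≡0 0₂ 0₂ _ = refl
two*[a+b]≡0 0₂ 1₂ ()
two*[a+b]≡0 1₂ 0₂ ()
two*[a+b]≡0 1₂ 1₂ _ = refl

two*z≡0 : ∀ z → two Z4.*ₙ z ≡ Z4.0# → dbl (hlf z) ≡ z
two*z≡0 0₄ _ = refl
two*z≡0 1₄ ()
two*z≡0 2₄ _ = refl
two*z≡0 3₄ ()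

half : ∀ m → (m + m) / 2 ≡ m
half m = trans (cong (_/ 2) m+m≡m*2) (m*n/n≡m m 2)
  where
  m+m≡m*2 : m + m ≡ m * 2
  m+m≡m*2 = sym (trans (ℕP.*-comm m 2) (cong (m +_) (ℕP.+-identityʳ m)))

gen₁-double : ∀ m β → gen₁ (m + m) β ≡ (double (Z2.e₀ m) , Z4.zeroV)
gen₁-double m β = cong (_, Z4.zeroV) (reduce-b m)
  where
  reduce-x^m-1 : ∀ m → Z2.reduce (m + m) (Z2.psub (Z2.X^ m) (Z2.pconst Z2.1#)) ≡ double (Z2.e₀ m)
  reduce-x^m-1 zero    = vec-empty _
  reduce-x^m-1 (suc k) = begin
    Z2.reduce (suc k + suc k) (Z2.1# L.∷ Z2.padd (Z2.X^ k) L.[])  ≡⟨ cong (λ p → Z2.reduce (suc k + suc k) (Z2.1# L.∷ p)) (Z2L.padd-identityʳ (Z2.X^ k)) ⟩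
    Z2.reduce (suc k + suc k) (Z2.1# L.∷ Z2.X^ k)                  ≡⟨ Z2L.act-padTo (Z2.1# L.∷ Z2.X^ k) (suc k + suc k) (s≤s degree<) ⟩
    Z2.1# ∷ Z2L.padTo (Z2.X^ k) (k + suc k)                        ≡⟨ cong (Z2.1# ∷_) (Z2L.padTo-X^ k k) ⟩
    double (Z2.e₀ (suc k))                                          ∎
    where
    open ≡-Reasoning
    degree< : L.length (Z2.X^ k) ≤ k + suc k
    degree< = ℕP.≤-trans (ℕP.≤-reflexive (Z2L.length-X^ k)) (ℕP.m≤n+m (suc k) k)
  reduce-b : ∀ m → Z2.reduce (m + m) (bPoly (m + m)) ≡ double (Z2.e₀ m)
  reduce-b m rewrite half m = reduce-x^m-1 m

gen₂-two : ∀ α β → gen₂ α β ≡ (Z2.zeroV , Z4.scaleV two (Z4.e₀ β))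
gen₂-two α β = cong (Z2.zeroV ,_) (reduce-fh+2f β)
  where
  open ≡-Reasoning
  reduce-fh+2f : ∀ β → Z4.reduce β (Z4.padd (Z4.pmul fPoly (hPoly β)) (Z4.pscale two fPoly)) ≡ Z4.scaleV two (Z4.e₀ β)
  reduce-fh+2f zero    = vec-empty _
  reduce-fh+2f (suc k) = begin
    Z4.reduce (suc k) (Z4.padd (Z4.pmul fPoly (hPoly (suc k))) (Z4.pscale two fPoly))  ≡⟨ cong (Z4.reduce (suc k)) fh+2f≡1+x^β ⟩
    Z4.reduce (suc k) (Z4.1# L.∷ Z4.X^ k)                                            ≡⟨ Z4L.reduce-c+X^ Z4.1# k ⟩
    Z4.scaleV Z4.1# (Z4.e₀ (suc k)) Z4.⊕ (Z4.1# ∷ Z4.zeroV)                          ≡⟨ cong (two ∷_) tail-zero ⟩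
    Z4.scaleV two (Z4.e₀ (suc k))                                                    ∎
    where
    fh+2f≡1+x^β : Z4.padd (Z4.pmul fPoly (hPoly (suc k))) (Z4.pscale two fPoly) ≡ Z4.1# L.∷ Z4.X^ k
    fh+2f≡1+x^β = cong (Z4.1# L.∷_) (begin
      Z4.padd (Z4.padd (Z4.pscale Z4.1# (Z4.padd (Z4.X^ k) L.[])) L.[]) L.[]  ≡⟨ Z4L.padd-identityʳ _ ⟩
      Z4.padd (Z4.pscale Z4.1# (Z4.padd (Z4.X^ k) L.[])) L.[]                ≡⟨ Z4L.padd-identityʳ _ ⟩
      Z4.pscale Z4.1# (Z4.padd (Z4.X^ k) L.[])                               ≡⟨ Z4L.pscale-identity _ ⟩
      Z4.padd (Z4.X^ k) L.[]                                                 ≡⟨ Z4L.padd-identityʳ _ ⟩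
      Z4.X^ k                                                                ∎)
    tail-zero : Z4.scaleV Z4.1# Z4.zeroV Z4.⊕ Z4.zeroV ≡ Z4.scaleV two (Z4.zeroV {k})
    tail-zero = trans (Z4L.⊕-identityʳ _) (trans (Z4L.scale-zero Z4.1#) (sym (Z4L.scale-zero two)))

Twin : ∀ m β → R (m + m) β → Set
Twin m β v = Σ (Vec (Fin 2) m) λ u → Σ (Vec (Fin 2) β) λ a → v ≡ (double u , V.map dbl a)

span-form : ∀ m β l₁ l₂ →
  V.foldr _ _⊞_ zeroR (zipWith _⋆_ (l₁ ∷ l₂ ∷ []) (gen₁ (m + m) β ∷ gen₂ (m + m) β ∷ []))
  ≡ (double (Z2.reduce m (L.map mod2 l₁)) , Z4.scaleV two (Z4.reduce β l₂))
span-form m β l₁ l₂ =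
  trans (cong₂ (λ g₁ g₂ → V.foldr _ _⊞_ zeroR (zipWith _⋆_ (l₁ ∷ l₂ ∷ []) (g₁ ∷ g₂ ∷ [])))
               (gen₁-double m β) (gen₂-two (m + m) β))
        (cong₂ _,_ binary quaternary)
  where
  open ≡-Reasoning
  binary : Z2.act (L.map mod2 l₁) (double (Z2.e₀ m)) Z2.⊕ (Z2.act (L.map mod2 l₂) Z2.zeroV Z2.⊕ Z2.zeroV)
           ≡ double (Z2.reduce m (L.map mod2 l₁))
  binary = begin
    _  ≡⟨ cong₂ Z2._⊕_ (Z2L.act-double (L.map mod2 l₁) (Z2.e₀ m))
            (trans (Z2L.⊕-identityʳ _) (Z2L.act-zero (L.map mod2 l₂))) ⟩
    _  ≡⟨ Z2L.⊕-identityʳ _ ⟩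
    _  ∎
  quaternary : Z4.act l₁ Z4.zeroV Z4.⊕ (Z4.act l₂ (Z4.scaleV two (Z4.e₀ β)) Z4.⊕ Z4.zeroV)
               ≡ Z4.scaleV two (Z4.reduce β l₂)
  quaternary = begin
    _  ≡⟨ cong₂ Z4._⊕_ (Z4L.act-zero l₁) (trans (Z4L.⊕-identityʳ _) (Z4L.act-scale l₂ two (Z4.e₀ β))) ⟩
    _  ≡⟨ Z4L.⊕-identityˡ _ ⟩
    _  ∎

code→twin : ∀ m β v → Code (m + m) β v → Twin m β v
code→twin m β v (l₁ ∷ l₂ ∷ [] , v≡) =
  Z2.reduce m (L.map mod2 l₁) , V.map mod2 (Z4.reduce β l₂) ,
  trans v≡ (trans (span-form m β l₁ l₂) (cong (_ ,_) scale-two))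
  where
  scale-two : Z4.scaleV two (Z4.reduce β l₂) ≡ V.map dbl (V.map mod2 (Z4.reduce β l₂))
  scale-two = trans (VP.map-cong two*≡dbl∘mod2 _) (VP.map-∘ dbl mod2 _)

-- ... and every such vector is a codeword: take λ₁ = u and λ₂ = a as polynomials.
twin→code : ∀ m β v → Twin m β v → Code (m + m) β v
twin→code m β .(double u , V.map dbl a) (u , a , refl) =
  (l₁ ∷ l₂ ∷ []) , sym (trans (span-form m β l₁ l₂) (cong₂ _,_ (cong double binary) quaternary))
  where
  l₁ l₂ : Z4.Poly
  l₁ = L.map lift (toList u)
  l₂ = toList (V.map lift a)
  binary : Z2.reduce m (L.map mod2 l₁) ≡ u
  binary = trans (cong (Z2.reduce m) mod2∘lift) (Z2L.reduce-toList u)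
    where
    mod2∘lift : L.map mod2 (L.map lift (toList u)) ≡ toList u
    mod2∘lift = trans (sym (LP.map-∘ (toList u))) (trans (LP.map-cong mod2-lift (toList u)) (LP.map-id (toList u)))
  quaternary : Z4.scaleV two (Z4.reduce β l₂) ≡ V.map dbl a
  quaternary = trans (cong (Z4.scaleV two) (Z4L.reduce-toList (V.map lift a))) (sym (VP.map-∘ (two Z4.*ₙ_) lift a))

dot-dbl : ∀ {k} (a a' : Vec (Fin 2) k) → Z4.dotV (V.map dbl a) (V.map dbl a') ≡ Z4.0#
dot-dbl []      []        = refl
dot-dbl (x ∷ a) (y ∷ a')  = cong₂ Z4._+ₙ_ (dbl*dbl x y) (dot-dbl a a')

dot-lift-double : ∀ {k} (u u' : Vec (Fin 2) k) →
  Z4.dotV (V.map lift (double u)) (V.map lift (double u')) ≡ Z4.dotV (V.map lift u) (V.map lift u') Z4.+ₙ Z4.dotV (V.map lift u) (V.map lift u')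
dot-lift-double u u' =
  trans (cong₂ Z4.dotV (VP.map-++ lift u u) (VP.map-++ lift u' u'))
        (Z4L.dot-++ (V.map lift u) (V.map lift u') (V.map lift u) (V.map lift u'))

twin-orthogonal : ∀ {m β} (u u' : Vec (Fin 2) m) (a a' : Vec (Fin 2) β) →
  inner {m + m} {β} (double u , V.map dbl a) (double u' , V.map dbl a') ≡ Z4.0#
twin-orthogonal u u' a a' =
  cong₂ Z4._+ₙ_ (trans (cong (two Z4.*ₙ_) (dot-lift-double u u')) (two*[s+s] (Z4.dotV (V.map lift u) (V.map lift u')))) (dot-dbl a a')

lift-unit : ∀ {k} (i : Fin k) → V.map lift (Z2L.unit i) ≡ Z4L.unit i
lift-unit {suc k} Fin.zero = cong (Z4.1# ∷_) (VP.map-replicate lift Z2.0# k)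
lift-unit (Fin.suc i) = cong (Z4.0# ∷_) (lift-unit i)

dbl-zero : ∀ {k} → V.map dbl (Z2.zeroV {k}) ≡ Z4.zeroV
dbl-zero = VP.map-replicate dbl Z2.0# _

lift-zero : ∀ {k} → V.map lift (Z2.zeroV {k}) ≡ Z4.zeroV
lift-zero = VP.map-replicate lift Z2.0# _

pair-binary-test : ∀ {m β} (i : Fin m) (w w' : Vec (Fin 2) m) (z : Vec (Fin 4) β) →
  inner (double (Z2L.unit i) , V.map dbl Z2.zeroV) (w ++ w' , z)
  ≡ two Z4.*ₙ (lift (V.lookup w i) Z4.+ₙ lift (V.lookup w' i))
pair-binary-test {m} i w w' z = begin
  (two Z4.*ₙ Z4.dotV (V.map lift (double (Z2L.unit i))) (V.map lift (w ++ w'))) Z4.+ₙ Z4.dotV (V.map dbl Z2.zeroV) z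
    ≡⟨ cong₂ (λ s t → (two Z4.*ₙ s) Z4.+ₙ t)
             (trans (cong₂ Z4.dotV (VP.map-++ lift (Z2L.unit i) (Z2L.unit i)) (VP.map-++ lift w w'))
                    (Z4L.dot-++ (V.map lift (Z2L.unit i)) (V.map lift w) (V.map lift (Z2L.unit i)) (V.map lift w')))
             (trans (cong (λ t → Z4.dotV t z) dbl-zero) (Z4L.dot-zeroˡ z)) ⟩
  (two Z4.*ₙ (lift-entry w Z4.+ₙ lift-entry w')) Z4.+ₙ Z4.0#
    ≡⟨ Z4A.+-identityʳ _ ⟩
  two Z4.*ₙ (lift-entry w Z4.+ₙ lift-entry w')
    ≡⟨ cong (two Z4.*ₙ_) (cong₂ Z4._+ₙ_ (entry w) (entry w')) ⟩
  two Z4.*ₙ (lift (V.lookup w i) Z4.+ₙ lift (V.lookup w' i))  ∎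
  where
  open ≡-Reasoning
  lift-entry : Vec (Fin 2) m → Fin 4
  lift-entry x = Z4.dotV (V.map lift (Z2L.unit i)) (V.map lift x)
  entry : ∀ x → lift-entry x ≡ lift (V.lookup x i)
  entry x = trans (cong (λ t → Z4.dotV t (V.map lift x)) (lift-unit i))
                  (trans (Z4L.dot-unit i (V.map lift x)) (VP.lookup-map i lift x))

pair-quaternary-test : ∀ {m β} (j : Fin β) (w : Vec (Fin 2) (m + m)) (z : Vec (Fin 4) β) →
  inner (double (Z2.zeroV {m}) , V.map dbl (Z2L.unit j)) (w , z) ≡ two Z4.*ₙ V.lookup z j
pair-quaternary-test {m} j w z = begin
  (two Z4.*ₙ Z4.dotV (V.map lift (double (Z2.zeroV {m}))) (V.map lift w)) Z4.+ₙ Z4.dotV (V.map dbl (Z2L.unit j)) z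
    ≡⟨ cong₂ Z4._+ₙ_ binary-part (cong (λ t → Z4.dotV t z) dbl-unit) ⟩
  Z4.0# Z4.+ₙ Z4.dotV (Z4.scaleV two (Z4L.unit j)) z
    ≡⟨ Z4A.+-identityˡ _ ⟩
  Z4.dotV (Z4.scaleV two (Z4L.unit j)) z
    ≡⟨ Z4L.dot-scaled-unit two j z ⟩
  two Z4.*ₙ V.lookup z j  ∎
  where
  open ≡-Reasoning
  binary-part : two Z4.*ₙ Z4.dotV (V.map lift (double (Z2.zeroV {m}))) (V.map lift w) ≡ Z4.0#
  binary-part = trans (cong (λ t → two Z4.*ₙ Z4.dotV (V.map lift t) (V.map lift w)) (sym (Z2L.double-zero {m})))
                      (trans (cong (λ t → two Z4.*ₙ Z4.dotV t (V.map lift w)) lift-zero)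
                             (trans (cong (two Z4.*ₙ_) (Z4L.dot-zeroˡ (V.map lift w))) (Z4A.*-zeroʳ two)))
  dbl-unit : V.map dbl (Z2L.unit j) ≡ Z4.scaleV two (Z4L.unit j)
  dbl-unit = trans (VP.map-∘ (two Z4.*ₙ_) lift (Z2L.unit j)) (cong (Z4.scaleV two) (lift-unit j))

-- A vector orthogonal to the whole code is a codeword: testing against
-- (eᵢ | eᵢ | 0) forces equal halves, testing against (0 | 0 | 2eⱼ) forces 2 | zⱼ.
dual→twin : ∀ m β v → Dual (Code (m + m) β) v → Twin m β v
dual→twin m β (w , z) ⊥C with V.splitAt m w
... | w₁ , w₂ , refl = w₁ , V.map hlf z , cong₂ _,_ (cong (w₁ ++_) (sym w₁≡w₂)) (sym z-even)
  where
  w₁≡w₂ : w₁ ≡ w₂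
  w₁≡w₂ = pointwise-≡ w₁ w₂ λ i →
    two*[a+b]≡0 _ _ (trans (sym (pair-binary-test i w₁ w₂ z))
                           (⊥C _ (twin→code m β _ (Z2L.unit i , Z2.zeroV , refl))))
  z-even : V.map dbl (V.map hlf z) ≡ z
  z-even = pointwise-≡ _ z λ j →
    trans (VP.lookup-map j dbl (V.map hlf z))
      (trans (cong dbl (VP.lookup-map j hlf z))
        (two*z≡0 _ (trans (sym (pair-quaternary-test {m} j (w₁ ++ w₂) z))
                          (⊥C _ (twin→code m β _ (Z2.zeroV , Z2L.unit j , refl))))))

selfDual : ∀ m β → SelfDual (Code (m + m) β)
selfDual m β v = (λ v∈C u u∈C → orthogonal u v (code→twin m β u u∈C) (code→twin m β v v∈C))
               , (λ v∈C⊥ → twin→code m β v (dual→twin m β v v∈C⊥))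
  where
  orthogonal : ∀ u v → Twin m β u → Twin m β v → inner u v ≡ Z4.0#
  orthogonal .(double x , V.map dbl a) .(double y , V.map dbl b) (x , a , refl) (y , b , refl) = twin-orthogonal x y a b

map-dbl-⊕ : ∀ {k} (x y : Vec (Fin 2) k) → V.map dbl (x Z2.⊕ y) ≡ V.map dbl x Z4.⊕ V.map dbl y
map-dbl-⊕ []      []      = refl
map-dbl-⊕ (a ∷ x) (b ∷ y) = cong₂ _∷_ (dbl-+ a b) (map-dbl-⊕ x y)

map-dbl-injective : ∀ {k} (x y : Vec (Fin 2) k) → V.map dbl x ≡ V.map dbl y → x ≡ y
map-dbl-injective []      []      _ = refl
map-dbl-injective (a ∷ x) (b ∷ y) e =
  cong₂ _∷_ (dbl-injective a b (VP.∷-injectiveˡ e)) (map-dbl-injective x y (VP.∷-injectiveʳ e))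

module _ (m β : ℕ) where

  embed : Vec (Fin 2) (β + m) × Vec (Fin 4) 0 → R (m + m) β
  embed (a , _) = double (V.drop β a) , V.map dbl (V.take β a)

  embed-hom : ∀ a b → embed (a +G b) ≡ embed a ⊞ embed b
  embed-hom (a , _) (b , _) = cong₂ _,_
    (trans (cong double (VP.drop-zipWith {m = β} Z2._+ₙ_ a b)) (sym (Z2L.double-⊕ (V.drop β a) (V.drop β b))))
    (trans (cong (V.map dbl) (VP.take-zipWith {m = β} Z2._+ₙ_ a b)) (map-dbl-⊕ (V.take β a) (V.take β b)))

  embed-injective : ∀ a b → embed a ≡ embed b → a ≡ b
  embed-injective (a , []) (b , []) e = cong (_, []) (begin
    a                              ≡⟨ sym (VP.take++drop≡id β a) ⟩
    V.take β a ++ V.drop β a       ≡⟨ cong₂ _++_ (map-dbl-injective _ _ (cong proj₂ e))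
                                                 (VP.++-injectiveˡ (V.drop β a) (V.drop β b) (cong proj₁ e)) ⟩
    V.take β b ++ V.drop β b       ≡⟨ VP.take++drop≡id β b ⟩
    b                              ∎)
    where open ≡-Reasoning

  groupIso : GroupIso (Code (m + m) β) (β + m) 0
  groupIso = embed , embed-hom , embed-injective , λ v → onto v , into v
    where
    onto : ∀ v → Code (m + m) β v → ∃ λ a → embed a ≡ v
    onto v v∈C with code→twin m β v v∈C
    ... | u , a , refl with take-drop-++ β a u
    ...   | take≡ , drop≡ = (a ++ u , []) , cong₂ _,_ (cong double drop≡) (cong (V.map dbl) take≡)
    into : ∀ v → (∃ λ a → embed a ≡ v) → Code (m + m) β v
    into v ((a , _) , refl) = twin→code m β _ (V.drop β a , V.take β a , refl)

hasDim : ∀ m β → HasDim (BinProjOrder2 (Code (m + m) β)) m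
hasDim m β = basis , injective , λ w → onto w , into w
  where
  basis : Vec (Vec (Fin 2) (m + m)) m
  basis = V.map double (V.tabulate Z2L.unit)
  span-basis : ∀ c → Z2L.lincomb c basis ≡ double c
  span-basis c = trans (Z2L.lincomb-double c (V.tabulate Z2L.unit)) (cong double (Z2L.lincomb-units c))
  injective : ∀ c c' → Z2L.lincomb c basis ≡ Z2L.lincomb c' basis → c ≡ c'
  injective c c' e = VP.++-injectiveˡ c c' (trans (sym (span-basis c)) (trans e (span-basis c')))
  onto : ∀ w → BinProjOrder2 (Code (m + m) β) w → ∃ λ c → Z2L.lincomb c basis ≡ w
  onto w (q , wq∈C , _) with code→twin m β (w , q) wq∈C
  ... | u , a , e = u , trans (span-basis u) (sym (cong proj₁ e))
  into : ∀ w → (∃ λ c → Z2L.lincomb c basis ≡ w) → BinProjOrder2 (Code (m + m) β) w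
  into w (c , refl) = Z4.zeroV
    , twin→code m β _ (c , Z2.zeroV , cong₂ _,_ (span-basis c) (sym dbl-zero))
    , cong₂ _,_ (self-sum _) (Z4L.⊕-identityʳ Z4.zeroV)
    where
    self-sum : ∀ {k} (v : Vec (Fin 2) k) → v Z2.⊕ v ≡ Z2.zeroV
    self-sum []      = refl
    self-sum (x ∷ v) = cong₂ _∷_ (x+x≡0 x) (self-sum v)

even⇒half+half : ∀ α → α % 2 ≡ 0 → α ≡ α / 2 + α / 2
even⇒half+half α α-even = begin
  α                      ≡⟨ m≡m%n+[m/n]*n α 2 ⟩
  α % 2 + α / 2 * 2      ≡⟨ cong (_+ α / 2 * 2) α-even ⟩
  α / 2 * 2              ≡⟨ ℕP.*-comm (α / 2) 2 ⟩
  α / 2 + (α / 2 + 0)    ≡⟨ cong (α / 2 +_) (ℕP.+-identityʳ (α / 2)) ⟩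
  α / 2 + α / 2          ∎
  where open ≡-Reasoning

selfDual-of-type : ∀ α m β → α ≡ m + m →
  SelfDual (Code α β) × HasType α β (Code α β) (β + m) 0 m
selfDual-of-type .(m + m) m β refl = selfDual m β , groupIso m β , hasDim m β

mainTheorem14 : ∀ (α β : ℕ) → α % 2 ≡ 0 → β % 2 ≡ 1 →
    SelfDual (Code α β) × HasType α β (Code α β) (β + α / 2) 0 (α / 2)
mainTheorem14 α β α-even _ = selfDual-of-type α (α / 2) β (even⇒half+half α α-even)
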